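{- If $P_n$ is the path on $n$ vertices, then the number of multipackings of $P_n$ is $O(1.47^n)$.
   Context: For a graph $G=(V,E)$ with shortest-path distance $d$, $N_r[v]=\{u\in V:d(u,v)\le r\}$. A multipacking of $G$ is a set $M\subseteq V$ (possibly empty) with $|N_r[v]\cap M|\le r$ for all $v\in V$ and all integers $r\ge1$. -}

module Defs where

open import Data.Nat using (ℕ; _≤_; _≤?_; ∣_-_∣; NonZero)
open import Data.Fin using (Fin; toℕ)
open import Data.Fin.Subset using (Subset; _∩_; ∣_∣)
open import Data.Vec using (tabulate)
open import Relation.Nullary using (does)

-- The path P_n: vertex set Fin n, vertex i adjacent to i+1.
-- Its shortest-path distance is d(u,v) = |u - v|.
pathDist : ∀ {n} → Fin n → Fin n → ℕ
pathDist u v = ∣ toℕ u - toℕ v ∣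

ball : ∀ {n} → ℕ → Fin n → Subset n
ball r v = tabulate (λ u → does (pathDist u v ≤? r))

IsMultipacking : ∀ {n} → Subset n → Set
IsMultipacking {n} M = (v : Fin n) (r : ℕ) → .{{NonZero r}} → ∣ ball r v ∩ M ∣ ≤ r

-- Two members of a multipacking of P_n at distance 1 or 2 both lie in the ball N_1[v]
-- around the vertex v just after the first one, so members are at least 3 apart. A set with
-- this property either omits the first vertex or contains it and omits the next two, so the
-- number a(n) of such sets obeys a(n+3) = a(n+2) + a(n). Hence a(n) grows like ρⁿ for the
-- real root ρ ≈ 1.4656 of x³ = x² + 1, and 1.47 > ρ since 100·147² + 100³ ≤ 147³.

{-# OPTIONS --safe #-}
module Submission where

open import Defs
open import Data.Nat using (ℕ; _≤_; _*_; _^_)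
open import Data.Product using (∃-syntax)
open import Data.List using (List; length)
open import Data.List.Relation.Unary.All using (All)
open import Data.List.Relation.Unary.Unique.Propositional using (Unique)
open import Data.Fin.Subset using (Subset)

open import Data.Nat using (zero; suc; _+_; _<_; ∣_-_∣; _≤?_; _<?_; z≤n; s≤s; s≤s⁻¹; z<s)
open import Data.Nat.Properties
open import Data.Nat.Tactic.RingSolver using (solve-∀)
open import Data.Product using (_,_)
open import Data.Sum using (inj₁; inj₂)
open import Data.Fin using (Fin; toℕ; fromℕ<) renaming (zero to fzero; suc to fsuc)
open import Data.Fin.Properties using (injective⇒≤; toℕ<n; toℕ-fromℕ<)
open import Data.Fin.Subset using (inside; outside; _∩_; ∣_∣)
  renaming (_∈_ to _∈ₛ_)
open import Data.Fin.Subset.Properties using (x∈p⇒∣p-x∣<∣p∣; x∈p∧x≢y⇒x∈p-y; x∈p∩q⁺)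
open import Data.List using ([]; _∷_; [_]; _++_; map; lookup)
open import Data.List.Properties using (length-++; length-map)
import Data.List.Relation.Unary.All as All
open import Data.List.Relation.Unary.AllPairs using (_∷_)
open import Data.List.Relation.Unary.Any using (here; index)
open import Data.List.Relation.Unary.Any.Properties using (lookup-index)
open import Data.List.Membership.Propositional using (_∈_)
open import Data.List.Membership.Propositional.Properties using (∈-lookup; ∈-map⁺; ∈-++⁺ˡ; ∈-++⁺ʳ)
open import Data.List.Relation.Binary.Subset.Propositional using (_⊆_)
open import Data.Vec using ([]; _∷_; here; there)
open import Data.Vec.Properties using (lookup⇒[]=; lookup∘tabulate)
open import Function.Base using (_∘_)
open import Function.Definitions using (Injective)
open import Relation.Binary.PropositionalEquality using (_≡_; _≢_; refl; sym; trans; cong; cong₂; subst; module ≡-Reasoning)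
open import Relation.Nullary using (yes; no; contradiction)
open import Relation.Nullary.Decidable using (dec-true)

Unique⇒lookup-injective : ∀ {A : Set} {xs : List A} → Unique xs → Injective _≡_ _≡_ (lookup xs)
Unique⇒lookup-injective {xs = _ ∷ _} (_ ∷ _) {fzero} {fzero} _ = refl
Unique⇒lookup-injective {xs = _ ∷ _} (x≢ ∷ _) {fzero} {fsuc j} eq =
  contradiction eq (All.lookup x≢ (∈-lookup j))
Unique⇒lookup-injective {xs = _ ∷ _} (x≢ ∷ _) {fsuc i} {fzero} eq =
  contradiction (sym eq) (All.lookup x≢ (∈-lookup i))
Unique⇒lookup-injective {xs = _ ∷ _} (_ ∷ unique) {fsuc i} {fsuc j} eq =
  cong fsuc (Unique⇒lookup-injective unique eq)

Unique⇒length-≤ : ∀ {A : Set} {xs ys : List A} → Unique xs → xs ⊆ ys → length xs ≤ length ys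
Unique⇒length-≤ {xs = xs} {ys} unique xs⊆ys = injective⇒≤ positionInYs-injective
  where
  positionInYs : Fin (length xs) → Fin (length ys)
  positionInYs i = index (xs⊆ys (∈-lookup i))

  positionInYs-injective : Injective _≡_ _≡_ positionInYs
  positionInYs-injective {i} {j} eq = Unique⇒lookup-injective unique (begin
    lookup xs i                ≡⟨ lookup-index (xs⊆ys (∈-lookup i)) ⟩
    lookup ys (positionInYs i) ≡⟨ cong (lookup ys) eq ⟩
    lookup ys (positionInYs j) ≡⟨ lookup-index (xs⊆ys (∈-lookup j)) ⟨
    lookup xs j                ∎)
    where open ≡-Reasoning

recurrence-growth : (f : ℕ → ℕ) {p q c : ℕ} →
  p * (q * q) + p * (p * p) ≤ q * (q * q) →
  (∀ n → f (3 + n) ≤ f (2 + n) + f n) →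
  f 0 * p ^ 0 ≤ c * q ^ 0 → f 1 * p ^ 1 ≤ c * q ^ 1 → f 2 * p ^ 2 ≤ c * q ^ 2 →
  ∀ n → f n * p ^ n ≤ c * q ^ n
recurrence-growth f {p} {q} {c} ratio recurrence bound₀ bound₁ bound₂ = bound
  where
  split : ∀ a b x X → (a + b) * (x * (x * (x * X))) ≡ a * (x * (x * X)) * x + b * X * (x * (x * x))
  split = solve-∀
  merge : ∀ k Y y x → k * (y * (y * Y)) * x + k * Y * (x * (x * x)) ≡ k * Y * (x * (y * y) + x * (x * x))
  merge = solve-∀
  shift : ∀ k Y y → k * Y * (y * (y * y)) ≡ k * (y * (y * (y * Y)))
  shift = solve-∀

  bound : ∀ n → f n * p ^ n ≤ c * q ^ n
  bound 0 = bound₀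
  bound 1 = bound₁
  bound 2 = bound₂
  bound (suc (suc (suc n))) = begin
    f (3 + n) * p ^ (3 + n)                                  ≤⟨ *-monoˡ-≤ (p ^ (3 + n)) (recurrence n) ⟩
    (f (2 + n) + f n) * p ^ (3 + n)                          ≡⟨ split (f (2 + n)) (f n) p (p ^ n) ⟩
    f (2 + n) * p ^ (2 + n) * p + f n * p ^ n * (p * (p * p)) ≤⟨ +-mono-≤ (*-monoˡ-≤ p (bound (suc (suc n))))
                                                                         (*-monoˡ-≤ (p * (p * p)) (bound n)) ⟩
    c * q ^ (2 + n) * p + c * q ^ n * (p * (p * p))          ≡⟨ merge c (q ^ n) q p ⟩
    c * q ^ n * (p * (q * q) + p * (p * p))                  ≤⟨ *-monoʳ-≤ (c * q ^ n) ratio ⟩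
    c * q ^ n * (q * (q * q))                                ≡⟨ shift c (q ^ n) q ⟩
    c * q ^ (3 + n)                                          ∎
    where open ≤-Reasoning

x∈p∧y∈p∧x≢y⇒2≤∣p∣ : ∀ {n} {p : Subset n} {x y : Fin n} → x ∈ₛ p → y ∈ₛ p → x ≢ y → 2 ≤ ∣ p ∣
x∈p∧y∈p∧x≢y⇒2≤∣p∣ x∈p y∈p x≢y =
  ≤-<-trans (≤-<-trans z≤n (x∈p⇒∣p-x∣<∣p∣ (x∈p∧x≢y⇒x∈p-y y∈p (x≢y ∘ sym)))) (x∈p⇒∣p-x∣<∣p∣ x∈p)

∣m-n∣≤o : ∀ {m n o} → m ≤ o + n → n ≤ o + m → ∣ m - n ∣ ≤ o
∣m-n∣≤o {m} {n} {o} m≤o+n n≤o+m with ∣m-n∣≡[m∸n]∨[n∸m] m n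
... | inj₁ eq rewrite eq = m≤n+o⇒m∸n≤o m n (subst (m ≤_) (+-comm o n) m≤o+n)
... | inj₂ eq rewrite eq = m≤n+o⇒m∸n≤o n m (subst (n ≤_) (+-comm o m) n≤o+m)

∈-ball : ∀ {n r} {u v : Fin n} → pathDist u v ≤ r → u ∈ₛ ball r v
∈-ball {r = r} {u} {v} u-near =
  lookup⇒[]= u _ (trans (lookup∘tabulate _ u) (dec-true (pathDist u v ≤? r) u-near))

Sparse : ∀ {n} → Subset n → Set
Sparse p = ∀ {i j} → i ∈ₛ p → j ∈ₛ p → toℕ i < toℕ j → 2 + toℕ i < toℕ j

multipacking⇒sparse : ∀ {n} {M : Subset n} → IsMultipacking M → Sparse M
multipacking⇒sparse {n} {M} packing {i} {j} i∈M j∈M i<j with 2 + toℕ i <? toℕ j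
... | yes far = far
... | no ¬far = contradiction (packing v 1) (<⇒≱ two-in-ball)
  where
  i+1<n : suc (toℕ i) < n
  i+1<n = ≤-<-trans i<j (toℕ<n j)

  v : Fin n
  v = fromℕ< i+1<n

  i-near : pathDist i v ≤ 1
  i-near rewrite toℕ-fromℕ< i+1<n = ∣m-n∣≤o (m≤n⇒m≤1+n (n≤1+n (toℕ i))) ≤-refl

  j-near : pathDist j v ≤ 1
  j-near rewrite toℕ-fromℕ< i+1<n = ∣m-n∣≤o (≮⇒≥ ¬far) (m≤n⇒m≤1+n i<j)

  two-in-ball : 2 ≤ ∣ ball 1 v ∩ M ∣
  two-in-ball = x∈p∧y∈p∧x≢y⇒2≤∣p∣ (x∈p∩q⁺ (∈-ball i-near , i∈M)) (x∈p∩q⁺ (∈-ball j-near , j∈M))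
                                  (λ i≡j → <-irrefl (cong toℕ i≡j) i<j)

Sparse-tail : ∀ {n b} {p : Subset n} → Sparse (b ∷ p) → Sparse p
Sparse-tail sparse i∈p j∈p i<j = s≤s⁻¹ (sparse (there i∈p) (there j∈p) (s≤s i<j))

-- The first k positions are forced empty: they are too close to a member just placed.
sparseFrom : ℕ → ∀ n → List (Subset n)
sparseFrom _       zero    = [ [] ]
sparseFrom zero    (suc n) = map (outside ∷_) (sparseFrom 0 n) ++ map (inside ∷_) (sparseFrom 2 n)
sparseFrom (suc k) (suc n) = map (outside ∷_) (sparseFrom k n)

∈-sparseFrom : ∀ k {n} (p : Subset n) → Sparse p → (∀ {i} → i ∈ₛ p → k ≤ toℕ i) → p ∈ sparseFrom k n
∈-sparseFrom _ [] _ _ = here refl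
∈-sparseFrom zero (outside ∷ p) sparse _ =
  ∈-++⁺ˡ (∈-map⁺ (outside ∷_) (∈-sparseFrom 0 p (Sparse-tail sparse) (λ _ → z≤n)))
∈-sparseFrom zero {suc n} (inside ∷ p) sparse _ =
  ∈-++⁺ʳ (map (outside ∷_) (sparseFrom 0 n)) (∈-map⁺ (inside ∷_) (∈-sparseFrom 2 p (Sparse-tail sparse) far))
  where
  far : ∀ {j} → j ∈ₛ p → 2 ≤ toℕ j
  far j∈p = s≤s⁻¹ (sparse here (there j∈p) z<s)
∈-sparseFrom (suc k) (outside ∷ p) sparse from =
  ∈-map⁺ (outside ∷_) (∈-sparseFrom k p (Sparse-tail sparse) (λ i∈p → s≤s⁻¹ (from (there i∈p))))
∈-sparseFrom (suc k) (inside ∷ p) _ from = contradiction (from here) λ ()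

length-sparseFrom-recurrence : ∀ n →
  length (sparseFrom 0 (3 + n)) ≡ length (sparseFrom 0 (2 + n)) + length (sparseFrom 0 n)
length-sparseFrom-recurrence n = begin
  length (sparseFrom 0 (3 + n))
    ≡⟨ length-++ (map (outside ∷_) (sparseFrom 0 (2 + n))) ⟩
  length (map (outside ∷_) (sparseFrom 0 (2 + n))) + length (map (inside ∷_) (sparseFrom 2 (2 + n)))
    ≡⟨ cong₂ _+_ (length-map _ (sparseFrom 0 (2 + n))) (length-map _ (sparseFrom 2 (2 + n))) ⟩
  length (sparseFrom 0 (2 + n)) + length (sparseFrom 2 (2 + n))
    ≡⟨ cong (length (sparseFrom 0 (2 + n)) +_)
            (trans (length-map _ (sparseFrom 1 (1 + n))) (length-map _ (sparseFrom 0 n))) ⟩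
  length (sparseFrom 0 (2 + n)) + length (sparseFrom 0 n)
    ∎
  where open ≡-Reasoning

length-sparseFrom-growth : ∀ n → length (sparseFrom 0 n) * 100 ^ n ≤ 2 * 147 ^ n
length-sparseFrom-growth = recurrence-growth (λ n → length (sparseFrom 0 n)) {100} {147} {2}
  (≤ᵇ⇒≤ _ _ _) (λ n → ≤-reflexive (length-sparseFrom-recurrence n)) (≤ᵇ⇒≤ _ _ _) (≤ᵇ⇒≤ _ _ _) (≤ᵇ⇒≤ _ _ _)

multipackings⊆sparseFrom : ∀ {n} {L : List (Subset n)} → All IsMultipacking L → L ⊆ sparseFrom 0 n
multipackings⊆sparseFrom packings M∈L =
  ∈-sparseFrom 0 _ (multipacking⇒sparse (All.lookup packings M∈L)) (λ _ → z≤n)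

proposition2 : ∃[ C ] ∃[ N ] ((n : ℕ) → N ≤ n → (L : List (Subset n)) → Unique L → All IsMultipacking L →
                   length L * 100 ^ n ≤ C * 147 ^ n)
proposition2 = 2 , 0 , λ n _ L unique packings → begin
  length L * 100 ^ n                ≤⟨ *-monoˡ-≤ (100 ^ n) (Unique⇒length-≤ unique (multipackings⊆sparseFrom packings)) ⟩
  length (sparseFrom 0 n) * 100 ^ n ≤⟨ length-sparseFrom-growth n ⟩
  2 * 147 ^ n                       ∎
  where open ≤-Reasoning
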